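{- Let $d$ be an odd integer. Then $U=\{(0,0)\}\cup\{(e,f)\in\mathcal{B}\mid f=d\}$ is avoidable in $\mathcal{B}$.
   Context: The bicyclic inverse semigroup is $\mathcal{B}=\{(a,b)\in\mathbb{Z}\times\mathbb{Z}\mid a\ge 0,\ a+b\ge 0\}$ with multiplication $(a,b)(c,d)=(\max\{c+d,a\}-d,\ b+d)$. A subset $U\subseteq\mathcal{B}$ is avoidable if $\mathcal{B}$ can be partitioned into two sets $A$ and $B$ such that no element of $U$ is a product $st$ of two distinct elements $s\ne t$ both in $A$ or both in $B$. -}

module Defs where

open import Data.Integer using (ℤ; +_; _+_; _-_; _≤_; _⊔_)
open import Data.Product using (Σ; _×_; _,_; proj₁; proj₂; ∃)
open import Data.Bool using (Bool)
open import Data.Sum using (_⊎_)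
open import Relation.Binary.PropositionalEquality using (_≡_)
open import Relation.Nullary using (¬_)

Pair : Set
Pair = ℤ × ℤ

-- Membership in the bicyclic inverse semigroup: a ≥ 0 and a + b ≥ 0
InB : Pair → Set
InB (a , b) = (+ 0 ≤ a) × (+ 0 ≤ a + b)

-- Elements of B (the membership proofs are propositional; we compare
-- elements via their underlying pairs)
𝓑 : Set
𝓑 = Σ Pair InB

pair : 𝓑 → Pair
pair = proj₁

_·_ : Pair → Pair → Pair
(a , b) · (c , d) = (((c + d) ⊔ a) - d , b + d)

Avoidable : (Pair → Set) → Set
Avoidable U = ∃ λ (colour : 𝓑 → Bool) →
  ∀ (s t : 𝓑) → ¬ (pair s ≡ pair t) → colour s ≡ colour t →
    ¬ U (pair s · pair t)

U-d : ℤ → Pair → Set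
U-d d (e , f) = ((e , f) ≡ (+ 0 , + 0)) ⊎ (InB (e , f) × (f ≡ d))

OddInt : ℤ → Set
OddInt d = ∃ λ (k : ℤ) → d ≡ (k + k) + + 1

module Submission where

-- Colour an element (a , b) of 𝓑 by c b, where c : ℤ → Bool is a
-- colouring of the integers.  The second coordinate of a product is
-- additive, (a , b)(c , e) = (… , b + e), so a monochromatic product lands
-- in {(e , f) | f = d} only if c b ≡ c e for some b + e = d.  The idempotent
-- (0 , 0) factors as a product of two distinct elements only as
-- (a , - m)(c , m) with m > 0.  Hence U-d d is avoidable as soon as c
-- separates every pair {b , d - b} and every pair {m , - m} with m > 0
-- (the record Separates below).
--
-- For d = 2k + 1 > 0 such a colouring exists: on ℕ let g 0 = false and
-- g (n + 1) = [k ≤ n mod d]; then g n ≠ g m whenever n + m = d, and g is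
-- d-periodic on positive arguments.  Extending g to ℤ by c (- m) = not (g m)
-- separates everything.  Negative d is reduced to positive d by the
-- symmetry x ↦ - x, flipping colours.

open import Defs
open import Data.Integer as ℤ using (ℤ; +_; -[1+_]; -_; _-_)
import Data.Integer.Properties as ℤ
open import Data.Nat as ℕ using (ℕ; zero; suc; _%_; _≤?_; s≤s)
import Data.Nat.Properties as ℕ
open import Data.Nat.DivMod using (m<n⇒m%n≡m; [m+n]%n≡m%n)
open import Data.Bool using (Bool; true; false; not)
open import Data.Bool.Properties using (not-involutive; not-¬)
open import Data.Product using (_,_; proj₁; proj₂; _×_; ∃)
open import Data.Sum using (_⊎_; inj₁; inj₂)
open import Relation.Nullary using (¬_; yes; no; contradiction)
open import Relation.Nullary.Decidable using (⌊_⌋)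
open import Relation.Binary.PropositionalEquality

record Separates (d : ℤ) (c : ℤ → Bool) : Set where
  field
    complementary : ∀ b e → b ℤ.+ e ≡ d → c b ≡ not (c e)
    antipodal     : ∀ m → c -[1+ m ] ≡ not (c (+ suc m))

mirror : ∀ {d c} → Separates d c → Separates (- d) (λ x → not (c (- x)))
mirror {d} {c} sep = record
  { complementary = λ b e b+e≡-d → cong not (complementary (- b) (- e) (negate b e b+e≡-d))
  ; antipodal     = λ m → trans (sym (antipodal m)) (sym (not-involutive _))
  }
  where
  open Separates sep
  negate : ∀ b e → b ℤ.+ e ≡ - d → - b ℤ.+ - e ≡ d
  negate b e b+e≡-d = begin
    - b ℤ.+ - e  ≡⟨ sym (ℤ.neg-distrib-+ b e) ⟩
    - (b ℤ.+ e)  ≡⟨ cong -_ b+e≡-d ⟩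
    - - d        ≡⟨ ℤ.neg-involutive d ⟩
    d            ∎
    where open ≡-Reasoning

-- The threshold test [k ≤ ·] takes opposite values on i and j when
-- i + j + 1 = 2k: exactly one of them lies in the upper half.
threshold : ∀ k i j → i ℕ.+ suc j ≡ k ℕ.+ k → ⌊ k ≤? i ⌋ ≡ not ⌊ k ≤? j ⌋
threshold k i j eq with k ≤? i | k ≤? j
... | yes k≤i | yes k≤j = contradiction
  (ℕ.≤-trans (s≤s (ℕ.+-mono-≤ k≤i k≤j)) (ℕ.≤-reflexive (trans (sym (ℕ.+-suc i j)) eq)))
  (ℕ.<-irrefl refl)
... | yes _   | no _    = refl
... | no _    | yes _   = refl
... | no k≰i  | no k≰j  = contradiction
  (ℕ.≤-trans (ℕ.≤-reflexive (cong suc (sym eq))) (ℕ.+-mono-≤ (ℕ.≰⇒> k≰i) (ℕ.≰⇒> k≰j)))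
  (ℕ.<-irrefl refl)

solve-for : ∀ b e {d} → b ℤ.+ e ≡ d → b ≡ d - e
solve-for b e {d} b+e≡d = begin
  b                  ≡⟨ sym (ℤ.+-identityʳ b) ⟩
  b ℤ.+ ℤ.0ℤ         ≡⟨ cong (λ x → b ℤ.+ x) (sym (ℤ.+-inverseʳ e)) ⟩
  b ℤ.+ (e - e)      ≡⟨ sym (ℤ.+-assoc b e (- e)) ⟩
  b ℤ.+ e - e        ≡⟨ cong (_- e) b+e≡d ⟩
  d - e              ∎
  where open ≡-Reasoning

module Positive (k : ℕ) where

  D : ℕ
  D = suc (k ℕ.+ k)

  g : ℕ → Bool
  g zero    = false
  g (suc n) = ⌊ k ≤? n % D ⌋

  g-suc-below : ∀ n → n ℕ.< D → g (suc n) ≡ ⌊ k ≤? n ⌋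
  g-suc-below n n<D = cong (λ r → ⌊ k ≤? r ⌋) (m<n⇒m%n≡m n<D)

  g-D : g D ≡ true
  g-D with k ≤? (k ℕ.+ k) % D
  ... | yes _   = refl
  ... | no k≰r  = contradiction
    (subst (k ℕ.≤_) (sym (m<n⇒m%n≡m (ℕ.n<1+n (k ℕ.+ k)))) (ℕ.m≤m+n k k)) k≰r

  g-complementary : ∀ n m → n ℕ.+ m ≡ D → g n ≡ not (g m)
  g-complementary zero    m       m≡D = sym (cong not (trans (cong g m≡D) g-D))
  g-complementary (suc i) zero    eq  = trans (cong g (trans (sym (ℕ.+-identityʳ (suc i))) eq)) g-D
  g-complementary (suc i) (suc j) eq  = begin
    g (suc i)        ≡⟨ g-suc-below i i<D ⟩
    ⌊ k ≤? i ⌋       ≡⟨ threshold k i j i+j+1≡2k ⟩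
    not ⌊ k ≤? j ⌋   ≡⟨ cong not (sym (g-suc-below j j<D)) ⟩
    not (g (suc j))  ∎
    where
    open ≡-Reasoning
    i+j+1≡2k : i ℕ.+ suc j ≡ k ℕ.+ k
    i+j+1≡2k = ℕ.suc-injective eq
    i<D : i ℕ.< D
    i<D = s≤s (subst (i ℕ.≤_) i+j+1≡2k (ℕ.m≤m+n i (suc j)))
    j<D : j ℕ.< D
    j<D = ℕ.≤-trans (subst (suc j ℕ.≤_) i+j+1≡2k (ℕ.m≤n+m (suc j) i)) (ℕ.n≤1+n _)

  g-periodic : ∀ j → g (D ℕ.+ suc j) ≡ g (suc j)
  g-periodic j = begin
    g (D ℕ.+ suc j)          ≡⟨ cong g (ℕ.+-suc D j) ⟩
    ⌊ k ≤? (D ℕ.+ j) % D ⌋  ≡⟨ cong (λ n → ⌊ k ≤? n % D ⌋) (ℕ.+-comm D j) ⟩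
    ⌊ k ≤? (j ℕ.+ D) % D ⌋  ≡⟨ cong (λ r → ⌊ k ≤? r ⌋) ([m+n]%n≡m%n j D) ⟩
    g (suc j)                ∎
    where open ≡-Reasoning

  colour : ℤ → Bool
  colour (+ n)    = g n
  colour -[1+ m ] = not (g (suc m))

  separates : Separates (+ D) colour
  separates = record { complementary = complementary ; antipodal = λ _ → refl }
    where
    -- A positive and a negative summand of D differ by a period.
    complementary : ∀ b e → b ℤ.+ e ≡ + D → colour b ≡ not (colour e)
    complementary (+ n) (+ m) eq = g-complementary n m (ℤ.+-injective eq)
    complementary (+ n) -[1+ m ] eq = begin
      g n                          ≡⟨ cong g (ℤ.+-injective (solve-for (+ n) -[1+ m ] eq)) ⟩
      g (D ℕ.+ suc m)              ≡⟨ g-periodic m ⟩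
      g (suc m)                    ≡⟨ sym (not-involutive _) ⟩
      not (not (g (suc m)))        ∎
      where open ≡-Reasoning
    complementary -[1+ n ] (+ m) eq = cong not (begin
      g (suc n)                    ≡⟨ sym (g-periodic n) ⟩
      g (D ℕ.+ suc n)              ≡⟨ cong g (sym (ℤ.+-injective (solve-for (+ m) -[1+ n ] (trans (ℤ.+-comm (+ m) -[1+ n ]) eq)))) ⟩
      g m                          ∎)
      where open ≡-Reasoning
    complementary -[1+ n ] -[1+ m ] ()

separating-for-odd : ∀ d → OddInt d → ∃ (Separates d)
separating-for-odd d (+ k , refl) =
  Positive.colour k , subst (λ d → Separates d (Positive.colour k))
                            (cong +_ (ℕ.+-comm 1 (k ℕ.+ k))) (Positive.separates k)
separating-for-odd d (-[1+ j ] , refl) = _ , mirror (Positive.separates j)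

factor-zero : (s t : 𝓑) → pair s · pair t ≡ (+ 0 , + 0) →
  pair s ≡ pair t ⊎ ∃ λ m → proj₂ (pair s) ≡ -[1+ m ] × proj₂ (pair t) ≡ + suc m
factor-zero ((a , b) , 0≤a , _) ((c , e) , 0≤c , _) st≡0 = by-sign e refl
  where
  ⊔≡e : (c ℤ.+ e) ℤ.⊔ a ≡ e
  ⊔≡e = ℤ.i-j≡0⇒i≡j _ _ (cong proj₁ st≡0)
  b≡-e : b ≡ - e
  b≡-e = trans (solve-for b e (cong proj₂ st≡0)) (ℤ.+-identityˡ (- e))
  a≤e : a ℤ.≤ e
  a≤e = subst (a ℤ.≤_) ⊔≡e (ℤ.i≤j⊔i (c ℤ.+ e) a)
  c≤0 : e ≡ + 0 → c ℤ.≤ + 0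
  c≤0 refl = subst₂ ℤ._≤_ (ℤ.+-identityʳ c) ⊔≡e (ℤ.i≤i⊔j (c ℤ.+ + 0) a)
  by-sign : ∀ e′ → e ≡ e′ →
    (a , b) ≡ (c , e) ⊎ ∃ λ m → b ≡ -[1+ m ] × e ≡ + suc m
  by-sign -[1+ m ] refl = contradiction (ℤ.≤-trans 0≤a a≤e) λ ()
  by-sign (+ zero) refl = inj₁ (cong₂ _,_
    (trans (ℤ.≤-antisym a≤e 0≤a) (ℤ.≤-antisym 0≤c (c≤0 refl))) b≡-e)
  by-sign (+ suc m) refl = inj₂ (m , b≡-e , refl)

avoidable-from : ∀ {d c} → Separates d c → Avoidable (U-d d)
avoidable-from {d} {c} sep = (λ s → c (proj₂ (pair s))) , no-monochromatic-factor
  where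
  open Separates sep
  no-monochromatic-factor : ∀ (s t : 𝓑) → ¬ (pair s ≡ pair t) →
    c (proj₂ (pair s)) ≡ c (proj₂ (pair t)) → ¬ U-d d (pair s · pair t)
  no-monochromatic-factor s t s≢t same (inj₂ (_ , b+e≡d)) =
    not-¬ same (complementary _ _ b+e≡d)
  no-monochromatic-factor s t s≢t same (inj₁ st≡0) with factor-zero s t st≡0
  ... | inj₁ s≡t = s≢t s≡t
  ... | inj₂ (m , b≡-m , e≡m) =
    not-¬ (trans (cong c (sym b≡-m)) (trans same (cong c e≡m))) (antipodal m)

mainTheorem18 : (d : ℤ) → OddInt d → Avoidable (U-d d)
mainTheorem18 d odd = avoidable-from (proj₂ (separating-for-odd d odd))
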